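{- Let $G$ be a clique-grid graph with representation $f:V(G)\to[t]\times[t']$, and let $H$ be a minimal backbone for $(G,f)$. Then for every $(i,j)\in[t]\times[t']$, $|f^{ -1}(i,j)\cap V(H)|\le 24$. Furthermore, the maximum degree of $H$ is at most $599$.
   Context: A graph $G$ is a clique-grid graph with representation $f:V(G)\to[t]\times[t']$ if (1) for every $(i,j)$, $f^{ -1}(i,j)$ is a clique, and (2) for every edge $\{u,v\}$ with $f(u)=(i,j)$, $f(v)=(i',j')$, $|i-i'|\le 2$ and $|j-j'|\le 2$. The pairs $(i,j)$ are called cells. An induced subgraph $H$ of $G$ is a backbone for $(G,f)$ if for every two distinct cells $(i,j),(i',j')$ such that some $u\in f^{ -1}(i,j)$ and $v\in f^{ -1}(i',j')$ satisfy $\{u,v\}\in E(G)$, there also exist $u'\in f^{ -1}(i,j)$, $v'\in f^{ -1}(i',j')$ with $\{u',v'\}\in E(H)$. A backbone $H$ is minimal if no proper induced subgraph of $H$ is a backbone for $(G,f)$. -}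

module Defs where

open import Data.Nat using (ℕ; _≤_; ∣_-_∣)
open import Data.Fin using (Fin; toℕ)
open import Data.Fin.Properties using (_≟_)
open import Data.Bool using (Bool; true; false)
open import Data.Product using (_×_; _,_; Σ; ∃; ∃-syntax; proj₁; proj₂)
open import Data.Product.Properties using (≡-dec)
open import Data.Vec using (tabulate)
open import Data.Fin.Subset using (Subset; _∈_; _∩_; ∣_∣; _⊂_)
open import Relation.Nullary using (¬_; does)
open import Relation.Binary.PropositionalEquality using (_≡_; _≢_)

record Graph (n : ℕ) : Set where
  field
    adj   : Fin n → Fin n → Bool
    sym   : ∀ u v → adj u v ≡ adj v u
    irrefl : ∀ v → adj v v ≡ false

open Graph public

Edge : ∀ {n} → Graph n → Fin n → Fin n → Set
Edge G u v = adj G u v ≡ true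

Cell : ℕ → ℕ → Set
Cell t t' = Fin t × Fin t'

record IsCliqueGrid {n : ℕ} (G : Graph n) (t t' : ℕ) (f : Fin n → Cell t t') : Set where
  field
    clique : ∀ u v → u ≢ v → f u ≡ f v → Edge G u v
    local  : ∀ u v → Edge G u v →
               ∣ toℕ (proj₁ (f u)) - toℕ (proj₁ (f v)) ∣ ≤ 2 ×
               ∣ toℕ (proj₂ (f u)) - toℕ (proj₂ (f v)) ∣ ≤ 2

-- An induced subgraph H of G is given by its vertex set S : Subset n.
-- S is a backbone for (G, f):
IsBackbone : ∀ {n t t'} → Graph n → (Fin n → Cell t t') → Subset n → Set
IsBackbone {n} G f S =
  ∀ (c c' : _) → c ≢ c' →
    (∃[ u ] ∃[ v ] (f u ≡ c × f v ≡ c' × Edge G u v)) →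
    ∃[ u' ] ∃[ v' ] (u' ∈ S × v' ∈ S × f u' ≡ c × f v' ≡ c' × Edge G u' v')

IsMinimalBackbone : ∀ {n t t'} → Graph n → (Fin n → Cell t t') → Subset n → Set
IsMinimalBackbone G f S = IsBackbone G f S × (∀ S' → S' ⊂ S → ¬ IsBackbone G f S')

cellSet : ∀ {n t t'} → (Fin n → Cell t t') → Cell t t' → Subset n
cellSet f c = tabulate (λ v → does (≡-dec _≟_ _≟_ (f v) c))

nbrs : ∀ {n} → Graph n → Fin n → Subset n
nbrs G v = tabulate (λ u → adj G v u)

degIn : ∀ {n} → Graph n → Subset n → Fin n → ℕ
degIn G S v = ∣ S ∩ nbrs G v ∣

module Submission where

-- Let S be a minimal backbone of a clique-grid graph (G , f).
-- For w ∈ S the set S ─ ⁅ w ⁆ is not a backbone, and the only way deleting w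
-- can destroy a backbone edge is when w has a *private cell*: a cell c ≠ f w
-- in which w has an S-neighbour, while no other S-vertex of w's own cell has
-- an S-neighbour in c.  Private cells of two vertices of the same cell must
-- differ, and a private cell lies within distance 2 of f w, so it is one of
-- the 24 cells around f w.  Labelling each w ∈ S by the offset of its private
-- cell therefore gives a labelling into Fin 24 that is injective on every cell.

open import Defs hiding (sym)
open import Data.Nat using (ℕ; zero; suc; _+_; _*_; _∸_; _≤_; z≤n; s≤s; ∣_-_∣)
import Data.Nat.Properties as ℕ
open import Data.Fin using (Fin; zero; suc; toℕ; fromℕ<; combine; punchOut)
open import Data.Fin.Properties
  using (_≟_; any?; toℕ-fromℕ<; toℕ-injective; suc-injective; combine-injective; punchOut-injective)
open import Data.Fin.Subset using (Subset; _∈_; _∩_; _─_; ∣_∣; ⁅_⁆)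
open import Data.Fin.Subset.Properties
  using (_∈?_; x∈p∩q⁺; x∈p∩q⁻; x∈⁅x⁆; x≢y⇒x∉⁅y⁆; x∈p∧x∉q⇒x∈p─q; p∩q≢∅⇒p─q⊂p)
open import Data.Bool using (true; false)
import Data.Bool.Properties as Bool
open import Data.Product using (_×_; _,_; proj₁; proj₂; ∃; ∃-syntax)
open import Data.Product.Properties using (≡-dec)
open import Data.Vec using ([]; _∷_; here; there)
open import Data.Vec.Properties using (lookup∘tabulate; []=⇒lookup)
open import Data.Empty using (⊥-elim)
open import Relation.Nullary using (¬_; Dec; yes; no; proof)
open import Relation.Nullary.Decidable using (_×-dec_; ¬?)
open import Relation.Nullary.Reflects using (Reflects; invert)
open import Relation.Binary.PropositionalEquality
  using (_≡_; _≢_; refl; sym; trans; cong; cong₂; subst)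

InjectiveOn : ∀ {n k} (A : Subset n) → (∀ x → x ∈ A → Fin k) → Set
InjectiveOn A h = ∀ x y px py → h x px ≡ h y py → x ≡ y

size-≤-injection : ∀ {n k} (A : Subset n) (h : ∀ x → x ∈ A → Fin k) →
                   InjectiveOn A h → ∣ A ∣ ≤ k
size-≤-injection [] h inj = z≤n
size-≤-injection (false ∷ A) h inj =
  size-≤-injection A (λ x p → h (suc x) (there p))
    (λ x y px py e → suc-injective (inj _ _ _ _ e))
size-≤-injection {k = zero} (true ∷ A) h inj with h zero here
... | ()
size-≤-injection {k = suc k} (true ∷ A) h inj =
  s≤s (size-≤-injection A (λ x p → punchOut (h₀≢ x p))
        (λ x y px py e → suc-injective (inj _ _ _ _ (punchOut-injective (h₀≢ x px) (h₀≢ y py) e))))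
  where
  h₀≢ : ∀ x p → h zero here ≢ h (suc x) (there p)
  h₀≢ x p e with inj _ _ _ _ e
  ... | ()

size-≤-injection-missing : ∀ {n m} (A : Subset n) (i : Fin m) (h : ∀ x → x ∈ A → Fin m) →
                           InjectiveOn A h → (∀ x p → i ≢ h x p) → ∣ A ∣ ≤ m ∸ 1
size-≤-injection-missing {m = suc m} A i h inj miss =
  size-≤-injection A (λ x p → punchOut (miss x p))
    (λ x y px py e → inj x y px py (punchOut-injective (miss x px) (miss y py) e))

-- Offsets: a number b within distance r of a is encoded by b + r ∸ a,
-- an element of Fin (2r + 1).

≤-+-dist : ∀ {r} a b → ∣ a - b ∣ ≤ r → a ≤ b + r
≤-+-dist {r} a b d = ℕ.≤-trans (ℕ.m≤n+∣m-n∣ a b) (ℕ.+-monoʳ-≤ b d)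

offset : ∀ r a b → ∣ a - b ∣ ≤ r → Fin (suc (r + r))
offset r a b d = fromℕ< (s≤s (ℕ.m≤n+o⇒m∸n≤o (b + r) a b+r≤a+2r))
  where
  b+r≤a+2r : b + r ≤ a + (r + r)
  b+r≤a+2r = ℕ.≤-trans (ℕ.+-monoˡ-≤ r (≤-+-dist b a (subst (_≤ r) (ℕ.∣-∣-comm a b) d)))
                       (ℕ.≤-reflexive (ℕ.+-assoc a r r))

offset-injective : ∀ r a b b' d d' → offset r a b d ≡ offset r a b' d' → b ≡ b'
offset-injective r a b b' d d' e =
  ℕ.+-cancelʳ-≡ r b b'
    (ℕ.∸-cancelʳ-≡ (≤-+-dist a b d) (≤-+-dist a b' d')
      (trans (sym (toℕ-fromℕ< _)) (trans (cong toℕ e) (toℕ-fromℕ< _))))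

dist-self : ∀ r a → ∣ a - a ∣ ≤ r
dist-self r a = subst (_≤ r) (sym (ℕ.∣n-n∣≡0 a)) z≤n

self-offset : ∀ r a → Fin (suc (r + r))
self-offset r a = offset r a a (dist-self r a)

self-offset-constant : ∀ r a → self-offset r a ≡ self-offset r 0
self-offset-constant r a =
  toℕ-injective (trans (toℕ-fromℕ< _) (trans (ℕ.m+n∸m≡n a r) (sym (toℕ-fromℕ< _))))

offset-middle : ∀ r a b d → offset r a b d ≡ self-offset r 0 → a ≡ b
offset-middle r a b d e =
  offset-injective r a a b (dist-self r a) d (trans (self-offset-constant r a) (sym e))

Near : ∀ {t t'} → Cell t t' → Cell t t' → Set
Near (i , j) (i' , j') = ∣ toℕ i - toℕ i' ∣ ≤ 2 × ∣ toℕ j - toℕ j' ∣ ≤ 2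

relPos : ∀ {t t'} (c d : Cell t t') → Near c d → Fin 25
relPos (i , j) (i' , j') (p , q) = combine (offset 2 (toℕ i) (toℕ i') p) (offset 2 (toℕ j) (toℕ j') q)

here-pos : Fin 25
here-pos = combine (self-offset 2 0) (self-offset 2 0)

relPos-injective : ∀ {t t'} (c c' d d' : Cell t t') p p' →
                   c ≡ c' → relPos c d p ≡ relPos c' d' p' → d ≡ d'
relPos-injective (i , j) .(i , j) (k , l) (k' , l') (p , q) (p' , q') refl e
  with combine-injective _ _ _ _ e
... | e₁ , e₂ = cong₂ _,_ (toℕ-injective (offset-injective 2 (toℕ i) _ _ p p' e₁))
                          (toℕ-injective (offset-injective 2 (toℕ j) _ _ q q' e₂))

relPos-here : ∀ {t t'} (c d : Cell t t') p → relPos c d p ≡ here-pos → c ≡ d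
relPos-here (i , j) (k , l) (p , q) e with combine-injective _ _ _ _ e
... | e₁ , e₂ = cong₂ _,_ (toℕ-injective (offset-middle 2 (toℕ i) _ p e₁))
                          (toℕ-injective (offset-middle 2 (toℕ j) _ q e₂))

_≟ᶜ_ : ∀ {t t'} (c d : Cell t t') → Dec (c ≡ d)
_≟ᶜ_ = ≡-dec _≟_ _≟_

∈cellSet⇒ : ∀ {n t t'} (f : Fin n → Cell t t') c {x} → x ∈ cellSet f c → f x ≡ c
∈cellSet⇒ f c {x} p =
  invert (subst (Reflects (f x ≡ c)) (trans (sym (lookup∘tabulate _ x)) ([]=⇒lookup p))
                (proof (f x ≟ᶜ c)))

∈nbrs⇒ : ∀ {n} (G : Graph n) v {x} → x ∈ nbrs G v → Edge G v x
∈nbrs⇒ G v {x} p = trans (sym (lookup∘tabulate _ x)) ([]=⇒lookup p)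

edge-sym : ∀ {n} (G : Graph n) {u v} → Edge G u v → Edge G v u
edge-sym G {u} {v} e = trans (Graph.sym G v u) e

edge-irrefl : ∀ {n} (G : Graph n) {u v} → Edge G u v → u ≢ v
edge-irrefl G e refl with trans (sym e) (Graph.irrefl G _)
... | ()

-- Counting with a cell-wise injective labelling.

module LabelledCells {n t t' k} (G : Graph n) (f : Fin n → Cell t t') (S : Subset n)
  (local : ∀ u v → Edge G u v → Near (f u) (f v))
  (label : ∀ x → x ∈ S → Fin k)
  (label-injective : ∀ x y px py → f x ≡ f y → label x px ≡ label y py → x ≡ y) where

  cell-size : ∀ c → ∣ cellSet f c ∩ S ∣ ≤ k
  cell-size c = size-≤-injection (cellSet f c ∩ S) (λ x p → label x (inS p))
    (λ x y px py → label-injective x y (inS px) (inS py)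
                     (trans (∈cellSet⇒ f c (inCell px)) (sym (∈cellSet⇒ f c (inCell py)))))
    where
    inCell : ∀ {x} → x ∈ cellSet f c ∩ S → x ∈ cellSet f c
    inCell p = proj₁ (x∈p∩q⁻ (cellSet f c) S p)
    inS : ∀ {x} → x ∈ cellSet f c ∩ S → x ∈ S
    inS p = proj₂ (x∈p∩q⁻ (cellSet f c) S p)

  degree : ∀ v → v ∈ S → degIn G S v ≤ 25 * k ∸ 1
  degree v vS = size-≤-injection-missing (S ∩ nbrs G v) (combine here-pos (label v vS)) code
      code-injective misses-v
    where
    inS : ∀ {x} → x ∈ S ∩ nbrs G v → x ∈ S
    inS p = proj₁ (x∈p∩q⁻ S (nbrs G v) p)
    edge : ∀ {x} → x ∈ S ∩ nbrs G v → Edge G v x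
    edge p = ∈nbrs⇒ G v (proj₂ (x∈p∩q⁻ S (nbrs G v) p))
    pos : ∀ x → x ∈ S ∩ nbrs G v → Fin 25
    pos x p = relPos (f v) (f x) (local v x (edge p))
    code : ∀ x → x ∈ S ∩ nbrs G v → Fin (25 * k)
    code x p = combine (pos x p) (label x (inS p))
    code-injective : InjectiveOn (S ∩ nbrs G v) code
    code-injective x y px py e
      with combine-injective (pos x px) (label x (inS px)) (pos y py) (label y (inS py)) e
    ... | e₁ , e₂ = label-injective x y (inS px) (inS py)
                      (relPos-injective (f v) (f v) (f x) (f y)
                         (local v x (edge px)) (local v y (edge py)) refl e₁) e₂
    misses-v : ∀ x p → combine here-pos (label v vS) ≢ code x p
    misses-v x p e with combine-injective here-pos (label v vS) (pos x p) (label x (inS p)) e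
    ... | e₁ , e₂ = edge-irrefl G (edge p)
                      (label-injective v x vS (inS p)
                         (relPos-here (f v) (f x) (local v x (edge p)) (sym e₁)) e₂)

module PrivateCells {n t t'} (G : Graph n) (f : Fin n → Cell t t') (S : Subset n) where

  NeighbourIn : Fin n → Cell t t' → Set
  NeighbourIn w c = ∃[ y ] (y ∈ S × f y ≡ c × Edge G w y)

  Shared : Fin n → Cell t t' → Set
  Shared w c = ∃[ x ] (x ∈ S × f x ≡ f w × x ≢ w × NeighbourIn x c)

  Private : Fin n → Cell t t' → Set
  Private w c = c ≢ f w × NeighbourIn w c × ¬ Shared w c

  neighbourIn? : ∀ w c → Dec (NeighbourIn w c)
  neighbourIn? w c = any? (λ y → (y ∈? S) ×-dec (f y ≟ᶜ c) ×-dec (adj G w y Bool.≟ true))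

  shared? : ∀ w c → Dec (Shared w c)
  shared? w c = any? (λ x → (x ∈? S) ×-dec (f x ≟ᶜ f w) ×-dec ¬? (x ≟ w) ×-dec neighbourIn? x c)

  private? : ∀ w c → Dec (Private w c)
  private? w c = ¬? (c ≟ᶜ f w) ×-dec neighbourIn? w c ×-dec ¬? (shared? w c)

  private-unique : ∀ {w w' c} → w' ∈ S → f w ≡ f w' → Private w c → Private w' c → w ≡ w'
  private-unique {w} {w'} w'S fw≡fw' (_ , _ , unshared) (_ , nbr' , _) with w ≟ w'
  ... | yes w≡w' = w≡w'
  ... | no w≢w' = ⊥-elim (unshared (w' , w'S , sym fw≡fw' , (λ e → w≢w' (sym e)) , nbr'))

  Witness : Subset n → Cell t t' → Cell t t' → Set
  Witness T c c' = ∃[ u ] ∃[ v ] (u ∈ T × v ∈ T × f u ≡ c × f v ≡ c' × Edge G u v)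

  witness-swap : ∀ {T c c'} → Witness T c c' → Witness T c' c
  witness-swap (u , v , uT , vT , fu , fv , e) = v , u , vT , uT , fv , fu , edge-sym G e

  module Deletion (w : Fin n) (no-private : ∀ c → ¬ Private w c) where

    ∈S─w : ∀ {x} → x ∈ S → x ≢ w → x ∈ S ─ ⁅ w ⁆
    ∈S─w xS x≢w = x∈p∧x∉q⇒x∈p─q xS (x≢y⇒x∉⁅y⁆ x≢w)

    shared : ∀ {c} → c ≢ f w → NeighbourIn w c → Shared w c
    shared {c} c≢fw nbr with shared? w c
    ... | yes s = s
    ... | no ¬s = ⊥-elim (no-private c (c≢fw , nbr , ¬s))

    reroute : ∀ {c c'} → c ≢ c' → w ∈ S → f w ≡ c → NeighbourIn w c' → Witness (S ─ ⁅ w ⁆) c c'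
    reroute c≢c' wS fw nbr with shared (λ e → c≢c' (trans (sym fw) (sym e))) nbr
    ... | x , xS , fx , x≢w , y , yS , fy , e =
      x , y , ∈S─w xS x≢w , ∈S─w yS (λ { refl → c≢c' (trans (sym fw) fy) }) ,
      trans fx fw , fy , e

    backbone : IsBackbone G f S → IsBackbone G f (S ─ ⁅ w ⁆)
    backbone bb c c' c≢c' ex with bb c c' c≢c' ex
    ... | u , v , uS , vS , fu , fv , e with u ≟ w | v ≟ w
    ... | yes refl | _ = reroute c≢c' uS fu (v , vS , fv , e)
    ... | no _ | yes refl =
          witness-swap (reroute (λ e → c≢c' (sym e)) vS fv (u , uS , fu , edge-sym G e))
    ... | no u≢w | no v≢w = u , v , ∈S─w uS u≢w , ∈S─w vS v≢w , fu , fv , e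

  private-cell : IsMinimalBackbone G f S → ∀ w → w ∈ S → ∃ (Private w)
  private-cell (bb , minimal) w wS with any? (λ i → any? (λ j → private? w (i , j)))
  ... | yes (i , j , p) = (i , j) , p
  ... | no none = ⊥-elim (minimal (S ─ ⁅ w ⁆)
          (p∩q≢∅⇒p─q⊂p S ⁅ w ⁆ (w , x∈p∩q⁺ (wS , x∈⁅x⁆ w)))
          (Deletion.backbone w (λ c p → none (proj₁ c , proj₂ c , p)) bb))

  -- Label a vertex by the relative position of its private cell; this
  -- position is never the cell itself, leaving 24 possibilities.
  module Labels (mb : IsMinimalBackbone G f S)
                (local : ∀ u v → Edge G u v → Near (f u) (f v)) where

    -- a private cell contains a neighbour of w, so by locality it is near f w
    private-near : ∀ {w c} → Private w c → Near (f w) c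
    private-near {w} (_ , (y , _ , fy , e) , _) = subst (Near (f w)) fy (local w y e)

    cell : ∀ w → w ∈ S → Cell t t'
    cell w wS = proj₁ (private-cell mb w wS)

    cell-private : ∀ w wS → Private w (cell w wS)
    cell-private w wS = proj₂ (private-cell mb w wS)

    position : ∀ w → w ∈ S → Fin 25
    position w wS = relPos (f w) (cell w wS) (private-near (cell-private w wS))

    position-not-here : ∀ w wS → here-pos ≢ position w wS
    position-not-here w wS e =
      proj₁ (cell-private w wS)
        (sym (relPos-here (f w) (cell w wS) (private-near (cell-private w wS)) (sym e)))

    label : ∀ w → w ∈ S → Fin 24
    label w wS = punchOut (position-not-here w wS)

    label-injective : ∀ x y px py → f x ≡ f y → label x px ≡ label y py → x ≡ y
    label-injective x y px py fx≡fy e =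
      private-unique py fx≡fy (cell-private x px)
        (subst (Private y) (sym same-cell) (cell-private y py))
      where
      same-cell : cell x px ≡ cell y py
      same-cell = relPos-injective (f x) (f y) (cell x px) (cell y py)
        (private-near (cell-private x px)) (private-near (cell-private y py)) fx≡fy
        (punchOut-injective (position-not-here x px) (position-not-here y py) e)

lemma12 : ∀ {n t t' : ℕ} (G : Graph n) (f : Fin n → Cell t t') (S : Subset n) →
              IsCliqueGrid G t t' f → IsMinimalBackbone G f S →
              (∀ (c : Cell t t') → ∣ cellSet f c ∩ S ∣ ≤ 24) ×
              (∀ (v : Fin n) → v ∈ S → degIn G S v ≤ 599)
lemma12 G f S cg mb = LabelledCells.cell-size G f S local label label-injective
                    , LabelledCells.degree G f S local label label-injective
  where
  local : ∀ u v → Edge G u v → Near (f u) (f v)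
  local = IsCliqueGrid.local cg
  open PrivateCells.Labels G f S mb local using (label; label-injective)
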